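{- Let $k\in\mathbb{N}$ and let $u,v$ be words over $\Sigma$ such that the $\mathrm{prefFO}$ $k$-types of $u$ and of $u\cdot v$ are both equal to some $\tau$. Then for every prefix $w$ of $v$, the $\mathrm{prefFO}$ $k$-type of $u\cdot w$ is $\tau$.
   Context: $\Sigma$ is a finite alphabet. Prefix first-order logic on words ($\mathrm{prefFO}$): first-order logic over (finite or infinite) words on $\Sigma$ with the order $<$ on positions and a unary predicate for each letter, restricted to sentences which start with a quantification (existential or universal) of a variable $\bar x$, after which every further quantification is of the form $\exists x<\bar x$ or $\forall x<\bar x$ (together with Boolean combinations of such sentences). The $\mathrm{prefFO}$ $k$-type of a word $w$ is the set of all $\mathrm{prefFO}$ sentences of quantifier depth at most $k$ satisfied by $w$. -}

module Defs where

open import Data.Nat using (ℕ; zero; suc; _<_; _≤_; _⊔_)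
open import Data.Fin using (Fin; fromℕ<)
  renaming (zero to fzero; suc to fsuc)
open import Data.List using (List; []; _∷_; length; lookup; _++_)
open import Data.Product using (Σ; ∃; _×_)
open import Data.Sum using (_⊎_)
open import Data.Unit using (⊤)
open import Relation.Nullary using (¬_)
open import Relation.Binary.PropositionalEquality using (_≡_)
open import Function.Bundles using (_⇔_)

data Word (m : ℕ) : Set where
  fin : List (Fin m) → Word m
  inf : (ℕ → Fin m) → Word m

Pos : ∀ {m} → Word m → ℕ → Set
Pos (fin l) i = i < length l
Pos (inf f) i = ⊤

At : ∀ {m} → Word m → ℕ → Fin m → Set
At (fin l) i a = Σ (i < length l) λ p → lookup l (fromℕ< p) ≡ a
At (inf f) i a = f i ≡ a

appendS : ∀ {m} → List (Fin m) → (ℕ → Fin m) → ℕ → Fin m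
appendS []       f i       = f i
appendS (x ∷ xs) f zero    = x
appendS (x ∷ xs) f (suc i) = appendS xs f i

_·_ : ∀ {m} → List (Fin m) → Word m → Word m
u · fin l = fin (u ++ l)
u · inf f = inf (appendS u f)

data IsPrefix {m : ℕ} : Word m → Word m → Set where
  fin-fin : ∀ (l r : List (Fin m)) → IsPrefix (fin l) (fin (l ++ r))
  fin-inf : ∀ (l : List (Fin m)) (f : ℕ → Fin m) →
            (∀ i (p : i < length l) → lookup l (fromℕ< p) ≡ f i) →
            IsPrefix (fin l) (inf f)
  inf-inf : ∀ (f g : ℕ → Fin m) → (∀ i → f i ≡ g i) → IsPrefix (inf f) (inf g)

-- Syntax of prefFO.
-- Terms in a formula with n bounded variables: the distinguished
-- variable x̄ ('bar') or one of the n variables bound by x<x̄ quantifiers.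

data Term (n : ℕ) : Set where
  bar : Term n
  var : Fin n → Term n

data BForm (m : ℕ) : ℕ → Set where
  letter : ∀ {n} → Fin m → Term n → BForm m n
  _<ᶠ_   : ∀ {n} → Term n → Term n → BForm m n
  _=ᶠ_   : ∀ {n} → Term n → Term n → BForm m n
  ¬ᶠ_    : ∀ {n} → BForm m n → BForm m n
  _∧ᶠ_   : ∀ {n} → BForm m n → BForm m n → BForm m n
  _∨ᶠ_   : ∀ {n} → BForm m n → BForm m n → BForm m n
  ∃<bar  : ∀ {n} → BForm m (suc n) → BForm m n
  ∀<bar  : ∀ {n} → BForm m (suc n) → BForm m n

data Sent (m : ℕ) : Set where
  ∃bar : BForm m 0 → Sent m
  ∀bar : BForm m 0 → Sent m
  ¬ˢ_  : Sent m → Sent m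
  _∧ˢ_ : Sent m → Sent m → Sent m
  _∨ˢ_ : Sent m → Sent m → Sent m

bdepth : ∀ {m n} → BForm m n → ℕ
bdepth (letter a t) = 0
bdepth (t <ᶠ t')    = 0
bdepth (t =ᶠ t')    = 0
bdepth (¬ᶠ φ)       = bdepth φ
bdepth (φ ∧ᶠ ψ)     = bdepth φ ⊔ bdepth ψ
bdepth (φ ∨ᶠ ψ)     = bdepth φ ⊔ bdepth ψ
bdepth (∃<bar φ)    = suc (bdepth φ)
bdepth (∀<bar φ)    = suc (bdepth φ)

depth : ∀ {m} → Sent m → ℕ
depth (∃bar φ) = suc (bdepth φ)
depth (∀bar φ) = suc (bdepth φ)
depth (¬ˢ φ)   = depth φ
depth (φ ∧ˢ ψ) = depth φ ⊔ depth ψ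
depth (φ ∨ˢ ψ) = depth φ ⊔ depth ψ

extend : ∀ {n} → ℕ → (Fin n → ℕ) → Fin (suc n) → ℕ
extend i ρ fzero    = i
extend i ρ (fsuc j) = ρ j

evalT : ∀ {n} → ℕ → (Fin n → ℕ) → Term n → ℕ
evalT x̄ ρ bar     = x̄
evalT x̄ ρ (var j) = ρ j

BSat : ∀ {m n} → Word m → ℕ → (Fin n → ℕ) → BForm m n → Set
BSat w x̄ ρ (letter a t) = At w (evalT x̄ ρ t) a
BSat w x̄ ρ (t <ᶠ t')    = evalT x̄ ρ t < evalT x̄ ρ t'
BSat w x̄ ρ (t =ᶠ t')    = evalT x̄ ρ t ≡ evalT x̄ ρ t'
BSat w x̄ ρ (¬ᶠ φ)       = ¬ BSat w x̄ ρ φ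
BSat w x̄ ρ (φ ∧ᶠ ψ)     = BSat w x̄ ρ φ × BSat w x̄ ρ ψ
BSat w x̄ ρ (φ ∨ᶠ ψ)     = BSat w x̄ ρ φ ⊎ BSat w x̄ ρ ψ
BSat w x̄ ρ (∃<bar φ)    = Σ ℕ λ i → i < x̄ × BSat w x̄ (extend i ρ) φ
BSat w x̄ ρ (∀<bar φ)    = ∀ i → i < x̄ → BSat w x̄ (extend i ρ) φ

noVars : Fin 0 → ℕ
noVars ()

_⊨_ : ∀ {m} → Word m → Sent m → Set
w ⊨ ∃bar φ   = Σ ℕ λ x̄ → Pos w x̄ × BSat w x̄ noVars φ
w ⊨ ∀bar φ   = ∀ x̄ → Pos w x̄ → BSat w x̄ noVars φ
w ⊨ (¬ˢ φ)   = ¬ (w ⊨ φ)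
w ⊨ (φ ∧ˢ ψ) = (w ⊨ φ) × (w ⊨ ψ)
w ⊨ (φ ∨ˢ ψ) = (w ⊨ φ) ⊎ (w ⊨ ψ)

Type : ∀ {m} → ℕ → Word m → Sent m → Set
Type k w φ = depth φ ≤ k × w ⊨ φ

HasType : ∀ {m} → ℕ → Word m → (Sent m → Set) → Set
HasType k w τ = ∀ φ → Type k w φ ⇔ τ φ

module Submission where

open import Defs
open import Data.Nat using (ℕ; zero; suc; _<_; _≤_; s≤s)
open import Data.Nat.Properties
  using (≤-refl; <⇒≤; ≤-<-trans; <-≤-trans; m≤m+n; m⊔n≤o⇒m≤o; m⊔n≤o⇒n≤o)
open import Data.Fin using (Fin; fromℕ<) renaming (zero to fzero; suc to fsuc)
open import Data.List using (List; []; _∷_; length; lookup; _++_)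
open import Data.List.Properties using (length-++; ++-assoc)
open import Data.Product using (Σ; _×_; _,_; proj₁; proj₂)
open import Data.Product.Function.NonDependent.Propositional using (_×-⇔_)
open import Data.Sum.Function.Propositional using (_⊎-⇔_)
open import Data.Unit using (tt)
open import Function.Bundles using (_⇔_; mk⇔; Equivalence)
open import Function.Construct.Identity using (⇔-id)
open import Function.Related.TypeIsomorphisms using (¬-cong-⇔)
open import Relation.Binary.PropositionalEquality
  using (_≡_; _≗_; refl; sym; trans; subst)

open Equivalence using (to; from)

-- A sentence ∃x̄ φ only needs one witness position x̄, and whether φ holds
-- there depends only on the letters at positions ≤ x̄; so its truth passes
-- from a word to every extension of it. Dually ∀x̄ φ passes to prefixes.
-- Hence if A ≤ B ≤ C in the prefix order and A, C satisfy the same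
-- sentences of depth ≤ k, then B is squeezed: an ∃-sentence true in B is
-- true in C, hence in A, and an ∀-sentence true in A is true in C, hence
-- in B; Boolean combinations follow by induction. Take A = u, B = u w,
-- C = u v.


_≼_ : ∀ {m} → Word m → Word m → Set
w ≼ w′ = ∀ i → Pos w i → Pos w′ i × (∀ a → At w i a ⇔ At w′ i a)

AgreeUpTo : ∀ {m} → ℕ → Word m → Word m → Set
AgreeUpTo x̄ w w′ = ∀ i → i ≤ x̄ → ∀ a → At w i a ⇔ At w′ i a

Pos-downwardClosed : ∀ {m} (w : Word m) {i j} → i ≤ j → Pos w j → Pos w i
Pos-downwardClosed (fin l) i≤j j<∣l∣ = ≤-<-trans i≤j j<∣l∣
Pos-downwardClosed (inf f) _   _     = tt

≼⇒AgreeUpTo : ∀ {m} {w w′ : Word m} {x̄} → w ≼ w′ → Pos w x̄ → AgreeUpTo x̄ w w′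
≼⇒AgreeUpTo {w = w} w≼w′ x̄∈w i i≤x̄ = proj₂ (w≼w′ i (Pos-downwardClosed w i≤x̄ x̄∈w))

lookup-++ˡ-fromℕ< : ∀ {m} (l r : List (Fin m)) i (p : i < length l) (q : i < length (l ++ r)) →
                    lookup (l ++ r) (fromℕ< q) ≡ lookup l (fromℕ< p)
lookup-++ˡ-fromℕ< (x ∷ l) r zero    _       _       = refl
lookup-++ˡ-fromℕ< (x ∷ l) r (suc i) (s≤s p) (s≤s q) = lookup-++ˡ-fromℕ< l r i p q

lookup-fromℕ<-appendS : ∀ {m} (u : List (Fin m)) (f : ℕ → Fin m) i (p : i < length u) →
                        lookup u (fromℕ< p) ≡ appendS u f i
lookup-fromℕ<-appendS (x ∷ u) f zero    _       = refl
lookup-fromℕ<-appendS (x ∷ u) f (suc i) (s≤s p) = lookup-fromℕ<-appendS u f i p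

lookup-++-appendS : ∀ {m} (u l : List (Fin m)) (f : ℕ → Fin m) →
                    (∀ i (p : i < length l) → lookup l (fromℕ< p) ≡ f i) →
                    ∀ i (p : i < length (u ++ l)) → lookup (u ++ l) (fromℕ< p) ≡ appendS u f i
lookup-++-appendS []      l f l≡f i       p       = l≡f i p
lookup-++-appendS (x ∷ u) l f l≡f zero    _       = refl
lookup-++-appendS (x ∷ u) l f l≡f (suc i) (s≤s p) = lookup-++-appendS u l f l≡f i p

appendS-congʳ : ∀ {m} (u : List (Fin m)) {f g : ℕ → Fin m} → f ≗ g → appendS u f ≗ appendS u g
appendS-congʳ []      f≗g i       = f≗g i
appendS-congʳ (x ∷ u) f≗g zero    = refl
appendS-congʳ (x ∷ u) f≗g (suc i) = appendS-congʳ u f≗g i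

IsPrefix⇒≼ : ∀ {m} {w w′ : Word m} → IsPrefix w w′ → w ≼ w′
IsPrefix⇒≼ (fin-fin l r) i i<∣l∣ = i<∣l++r∣ , λ a → mk⇔
    (λ (p , e) → i<∣l++r∣ , trans (lookup-++ˡ-fromℕ< l r i p i<∣l++r∣) e)
    (λ (q , e) → i<∣l∣ , trans (sym (lookup-++ˡ-fromℕ< l r i i<∣l∣ q)) e)
  where
  i<∣l++r∣ : i < length (l ++ r)
  i<∣l++r∣ = subst (i <_) (sym (length-++ l)) (<-≤-trans i<∣l∣ (m≤m+n (length l) (length r)))
IsPrefix⇒≼ (fin-inf l f l≡f) i i<∣l∣ = tt , λ a → mk⇔
    (λ (p , e) → trans (sym (l≡f i p)) e)
    (λ e → i<∣l∣ , trans (l≡f i i<∣l∣) e)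
IsPrefix⇒≼ (inf-inf f g f≗g) i _ = tt , λ a → mk⇔ (trans (sym (f≗g i))) (trans (f≗g i))

·-prefix : ∀ {m} (u : List (Fin m)) (w : Word m) → IsPrefix (fin u) (u · w)
·-prefix u (fin l) = fin-fin u l
·-prefix u (inf f) = fin-inf u (appendS u f) (lookup-fromℕ<-appendS u f)

·-monoʳ-IsPrefix : ∀ {m} (u : List (Fin m)) {w v : Word m} → IsPrefix w v → IsPrefix (u · w) (u · v)
·-monoʳ-IsPrefix u (fin-fin l r) =
  subst (λ ul·r → IsPrefix (fin (u ++ l)) (fin ul·r)) (++-assoc u l r) (fin-fin (u ++ l) r)
·-monoʳ-IsPrefix u (fin-inf l f l≡f) = fin-inf (u ++ l) (appendS u f) (lookup-++-appendS u l f l≡f)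
·-monoʳ-IsPrefix u (inf-inf f g f≗g) = inf-inf (appendS u f) (appendS u g) (appendS-congʳ u f≗g)


∃<-cong : ∀ {x̄} {P Q : ℕ → Set} → (∀ i → i < x̄ → P i ⇔ Q i) →
          (Σ ℕ λ i → i < x̄ × P i) ⇔ (Σ ℕ λ i → i < x̄ × Q i)
∃<-cong P⇔Q = mk⇔ (λ (i , i<x̄ , p) → i , i<x̄ , to   (P⇔Q i i<x̄) p)
                  (λ (i , i<x̄ , q) → i , i<x̄ , from (P⇔Q i i<x̄) q)

∀<-cong : ∀ {x̄} {P Q : ℕ → Set} → (∀ i → i < x̄ → P i ⇔ Q i) →
          (∀ i → i < x̄ → P i) ⇔ (∀ i → i < x̄ → Q i)
∀<-cong P⇔Q = mk⇔ (λ p i i<x̄ → to   (P⇔Q i i<x̄) (p i i<x̄))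
                  (λ q i i<x̄ → from (P⇔Q i i<x̄) (q i i<x̄))

module _ {m} {w w′ : Word m} {x̄ : ℕ} (agree : AgreeUpTo x̄ w w′) where

  evalT-≤ : ∀ {n} {ρ : Fin n → ℕ} → (∀ j → ρ j ≤ x̄) → ∀ t → evalT x̄ ρ t ≤ x̄
  evalT-≤ ρ≤x̄ bar     = ≤-refl
  evalT-≤ ρ≤x̄ (var j) = ρ≤x̄ j

  extend-≤ : ∀ {n} {ρ : Fin n → ℕ} {i} → (∀ j → ρ j ≤ x̄) → i < x̄ → ∀ j → extend i ρ j ≤ x̄
  extend-≤ ρ≤x̄ i<x̄ fzero    = <⇒≤ i<x̄
  extend-≤ ρ≤x̄ i<x̄ (fsuc j) = ρ≤x̄ j

  BSat-cong : ∀ {n} {ρ : Fin n → ℕ} → (∀ j → ρ j ≤ x̄) → (φ : BForm m n) →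
              BSat w x̄ ρ φ ⇔ BSat w′ x̄ ρ φ
  BSat-cong ρ≤x̄ (letter a t) = agree _ (evalT-≤ ρ≤x̄ t) a
  BSat-cong ρ≤x̄ (t <ᶠ t′)    = ⇔-id _
  BSat-cong ρ≤x̄ (t =ᶠ t′)    = ⇔-id _
  BSat-cong ρ≤x̄ (¬ᶠ φ)       = ¬-cong-⇔ (BSat-cong ρ≤x̄ φ)
  BSat-cong ρ≤x̄ (φ ∧ᶠ ψ)     = BSat-cong ρ≤x̄ φ ×-⇔ BSat-cong ρ≤x̄ ψ
  BSat-cong ρ≤x̄ (φ ∨ᶠ ψ)     = BSat-cong ρ≤x̄ φ ⊎-⇔ BSat-cong ρ≤x̄ ψ
  BSat-cong ρ≤x̄ (∃<bar φ)    = ∃<-cong λ i i<x̄ → BSat-cong (extend-≤ ρ≤x̄ i<x̄) φ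
  BSat-cong ρ≤x̄ (∀<bar φ)    = ∀<-cong λ i i<x̄ → BSat-cong (extend-≤ ρ≤x̄ i<x̄) φ

noVars-≤ : ∀ x̄ (j : Fin 0) → noVars j ≤ x̄
noVars-≤ x̄ ()

BSat-≼ : ∀ {m} {w w′ : Word m} {x̄} → w ≼ w′ → Pos w x̄ → (φ : BForm m 0) →
         BSat w x̄ noVars φ ⇔ BSat w′ x̄ noVars φ
BSat-≼ {x̄ = x̄} w≼w′ x̄∈w = BSat-cong (≼⇒AgreeUpTo w≼w′ x̄∈w) (noVars-≤ x̄)

⊨∃bar-mono : ∀ {m} {w w′ : Word m} → w ≼ w′ → ∀ φ → w ⊨ ∃bar φ → w′ ⊨ ∃bar φ
⊨∃bar-mono w≼w′ φ (x̄ , x̄∈w , sat) = x̄ , proj₁ (w≼w′ x̄ x̄∈w) , to (BSat-≼ w≼w′ x̄∈w φ) sat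

⊨∀bar-antimono : ∀ {m} {w w′ : Word m} → w ≼ w′ → ∀ φ → w′ ⊨ ∀bar φ → w ⊨ ∀bar φ
⊨∀bar-antimono w≼w′ φ sat x̄ x̄∈w = from (BSat-≼ w≼w′ x̄∈w φ) (sat x̄ (proj₁ (w≼w′ x̄ x̄∈w)))


_≅[_]_ : ∀ {m} → Word m → ℕ → Word m → Set
w ≅[ k ] w′ = ∀ φ → depth φ ≤ k → (w ⊨ φ) ⇔ (w′ ⊨ φ)

≅-sandwich : ∀ {m} {k} {A B C : Word m} → A ≼ B → B ≼ C → A ≅[ k ] C → A ≅[ k ] B
≅-sandwich A≼B B≼C A≅C (∃bar φ) d =
  mk⇔ (⊨∃bar-mono A≼B φ) (λ B⊨ → from (A≅C (∃bar φ) d) (⊨∃bar-mono B≼C φ B⊨))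
≅-sandwich A≼B B≼C A≅C (∀bar φ) d =
  mk⇔ (λ A⊨ → ⊨∀bar-antimono B≼C φ (to (A≅C (∀bar φ) d) A⊨)) (⊨∀bar-antimono A≼B φ)
≅-sandwich A≼B B≼C A≅C (¬ˢ φ) d = ¬-cong-⇔ (≅-sandwich A≼B B≼C A≅C φ d)
≅-sandwich A≼B B≼C A≅C (φ ∧ˢ ψ) d =
  ≅-sandwich A≼B B≼C A≅C φ (m⊔n≤o⇒m≤o (depth φ) _ d)
    ×-⇔ ≅-sandwich A≼B B≼C A≅C ψ (m⊔n≤o⇒n≤o (depth φ) _ d)
≅-sandwich A≼B B≼C A≅C (φ ∨ˢ ψ) d =
  ≅-sandwich A≼B B≼C A≅C φ (m⊔n≤o⇒m≤o (depth φ) _ d)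
    ⊎-⇔ ≅-sandwich A≼B B≼C A≅C ψ (m⊔n≤o⇒n≤o (depth φ) _ d)

HasType⇒≅ : ∀ {m} {k} {w w′ : Word m} {τ} → HasType k w τ → HasType k w′ τ → w ≅[ k ] w′
HasType⇒≅ w∶τ w′∶τ φ d = mk⇔
  (λ w⊨φ  → proj₂ (from (w′∶τ φ) (to (w∶τ  φ) (d , w⊨φ))))
  (λ w′⊨φ → proj₂ (from (w∶τ  φ) (to (w′∶τ φ) (d , w′⊨φ))))

HasType-resp-≅ : ∀ {m} {k} {w w′ : Word m} {τ} → w ≅[ k ] w′ → HasType k w τ → HasType k w′ τ
HasType-resp-≅ w≅w′ w∶τ φ = mk⇔
  (λ (d , w′⊨φ) → to (w∶τ φ) (d , from (w≅w′ φ d) w′⊨φ))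
  (λ τφ → let (d , w⊨φ) = from (w∶τ φ) τφ in d , to (w≅w′ φ d) w⊨φ)

lemma2 : (m k : ℕ) (u : List (Fin m)) (v : Word m) (τ : Sent m → Set) →
         HasType k (fin u) τ →
         HasType k (u · v) τ →
         (w : Word m) → IsPrefix w v →
         HasType k (u · w) τ
lemma2 m k u v τ u∶τ uv∶τ w w⊑v = HasType-resp-≅ u≅uw u∶τ
  where
  u≅uw : fin u ≅[ k ] (u · w)
  u≅uw = ≅-sandwich (IsPrefix⇒≼ (·-prefix u w)) (IsPrefix⇒≼ (·-monoʳ-IsPrefix u w⊑v))
                    (HasType⇒≅ u∶τ uv∶τ)
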